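{- Let $D\subseteq[d]$ and let $\delta\le 1/4$. Let $I$ be a finite set of items, each having nonnegative weights $v_1(i),\dots,v_d(i)$, and let $V_j\ge 0$ ($j\in D$) satisfy $\sum_{i\in I}v_j(i)\le V_j$ for all $j\in D$. Then $I$ can be partitioned into at most $|D|+1$ disjoint subsets such that each subset $I'$ satisfies $|I'|=1$ or $\sum_{i\in I'}v_j(i)\le(1-\delta)V_j$ for all $j\in D$.
   Formalization: The weights $v_1(i),\dots,v_d(i)$, the bounds $V_j$ and the parameter $\delta$ are rational. -}

module Defs where

open import Data.Nat using (ℕ; zero; suc)
open import Data.Fin using (Fin; _≟_)
open import Data.Fin.Subset using (Subset)
open import Data.Rational using (ℚ; 0ℚ; _+_)
open import Data.Vec using (tabulate)
open import Data.Bool using (if_then_else_)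
open import Relation.Nullary.Decidable using (⌊_⌋)

sumFin : (n : ℕ) → (Fin n → ℚ) → ℚ
sumFin zero    f = 0ℚ
sumFin (suc n) f = f Fin.zero + sumFin n (λ i → f (Fin.suc i))

part : {n m : ℕ} → (Fin n → Fin m) → Fin m → Subset n
part c k = tabulate (λ i → ⌊ c i ≟ k ⌋)

partSum : {n m : ℕ} → (Fin n → Fin m) → Fin m → (Fin n → ℚ) → ℚ
partSum {n} c k w = sumFin n (λ i → if ⌊ c i ≟ k ⌋ then w i else 0ℚ)

{-# OPTIONS --safe #-}
-- Refine a labelling one coordinate j ∈ D at a time, adding one part per coordinate.
-- With total weight at most V and bound B = (1 - δ)V ≥ 3V/4, at most one part is heavier
-- than B, since two such parts would weigh more than V.  That part is cut into two pieces,
-- each a singleton or of weight at most B: split off an item of weight above V/4 if there is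
-- one; otherwise fill the first piece greedily up to V/2, so that the rest weighs under 3V/4.
-- Being a singleton or within bound passes to subsets, so earlier coordinates stay satisfied.
module Submission where

open import Defs
open import Data.Nat using (ℕ; suc)
open import Data.Fin using (Fin)
open import Data.Fin.Subset using (Subset; _∈_; ∣_∣)
open import Data.Rational using (ℚ; 0ℚ; 1ℚ; _≤_; _-_; _*_; ½)
open import Data.Product using (Σ; _×_)
open import Data.Sum using (_⊎_)
open import Relation.Binary.PropositionalEquality using (_≡_)

open import Function using (_∘_; case_of_)
open import Data.Bool using (Bool; if_then_else_)
import Data.Nat as ℕ
open import Data.Nat.Properties using (n≮0)
open import Data.Fin using (zero; suc; _≟_)
open import Data.Fin.Subset using (inside; outside; ⊥; ⊤; ⁅_⁆; _⊆_; _─_)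
open import Data.Fin.Subset.Properties
  using (_∈?_; drop-∷-⊆; out⊆; in⊆in; ⊥⊆; ⊆-trans; ∈⊤; ⊆⊤; x∈⁅y⁆⇒x≡y; ∣⁅x⁆∣≡1;
         x∈p∧x∉q⇒x∈p─q; p─q⊆p; p⊆q⇒∣p∣≤∣q∣; x∈p⇒∣p-x∣<∣p∣; Empty-unique)
open import Data.Fin.Properties using (any?; suc-injective)
open import Data.Rational using (_+_; -_; _<_; nonNegative)
open import Data.Rational.Properties
  using (≤-refl; ≤-trans; ≤-reflexive; <⇒≤; ≮⇒≥; ≰⇒>; <-≤-trans; _≤?_; _<?_;
         +-monoˡ-≤; +-monoʳ-≤; +-monoʳ-<; +-comm; +-assoc; +-identityˡ; +-identityʳ;
         +-inverseʳ; nonNegative⁻¹; nonNeg*nonNeg⇒nonNeg; +-0-commutativeMonoid)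
open import Data.Rational.Solver using (module +-*-Solver)
open import Algebra.Bundles using (CommutativeMonoid)
open import Algebra.Properties.CommutativeSemigroup
  (CommutativeMonoid.commutativeSemigroup +-0-commutativeMonoid) using (x∙yz≈y∙xz)
open import Data.Product using (_,_; ∃)
open import Data.Sum using (inj₁; inj₂; map₁)
import Data.Sum as Sum
open import Data.Vec using ([]; _∷_; tabulate; here; there)
open import Data.Vec.Properties using (lookup∘tabulate; []=⇒lookup; lookup⇒[]=)
open import Relation.Nullary using (yes; no; _×-dec_)
open import Relation.Nullary.Decidable using (⌊_⌋; dec-true; isYes≗does)
open import Relation.Binary.PropositionalEquality
  using (refl; sym; trans; cong; subst; _≢_)

private
  variable
    n m m′ d : ℕ
    p q : Subset n
    w : Fin n → ℚ

module _ where
  open +-*-Solver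

  p+[q-p]≡q : ∀ p q → p + (q - p) ≡ q
  p+[q-p]≡q = solve 2 (λ p q → p :+ (q :- p) := q) refl

  p+q-q≡p : ∀ p q → p + q - q ≡ p
  p+q-q≡p = solve 2 (λ p q → p :+ q :- q := p) refl

¼ : ℚ
¼ = ½ * ½

p≤p+q : ∀ {p q} → 0ℚ ≤ q → p ≤ p + q
p≤p+q {p} 0≤q = subst (_≤ p + _) (+-identityʳ p) (+-monoʳ-≤ p 0≤q)

p≤q⇒0≤q-p : ∀ {p q} → p ≤ q → 0ℚ ≤ q - p
p≤q⇒0≤q-p {p} {q} p≤q = subst (_≤ q - p) (+-inverseʳ p) (+-monoˡ-≤ (- p) p≤q)

*-nonNeg : ∀ {p q} → 0ℚ ≤ p → 0ℚ ≤ q → 0ℚ ≤ p * q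
*-nonNeg {p} {q} 0≤p 0≤q =
  nonNegative⁻¹ _ {{nonNeg*nonNeg⇒nonNeg p {{nonNegative 0≤p}} q {{nonNegative 0≤q}}}}

+-cancelʳ-≤ : ∀ r {p q} → p + r ≤ q + r → p ≤ q
+-cancelʳ-≤ r {p} {q} h =
  subst (_≤ q) (p+q-q≡p p r) (subst (p + r - r ≤_) (p+q-q≡p q r) (+-monoˡ-≤ (- r) h))

p+q≤r+s⇒s≤p⇒q≤r : ∀ {p q r s} → p + q ≤ r + s → s ≤ p → q ≤ r
p+q≤r+s⇒s≤p⇒q≤r {p} {q} {r} {s} h s≤p = +-cancelʳ-≤ s (begin
  q + s ≤⟨ +-monoʳ-≤ q s≤p ⟩
  q + p ≡⟨ +-comm q p ⟩
  p + q ≤⟨ h ⟩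
  r + s ∎)
  where open Data.Rational.Properties.≤-Reasoning

sumOver : Subset n → (Fin n → ℚ) → ℚ
sumOver []            w = 0ℚ
sumOver (outside ∷ p) w = sumOver p (w ∘ suc)
sumOver (inside  ∷ p) w = w zero + sumOver p (w ∘ suc)

sumFin≡sumOver-⊤ : ∀ n (w : Fin n → ℚ) → sumFin n w ≡ sumOver ⊤ w
sumFin≡sumOver-⊤ ℕ.zero w = refl
sumFin≡sumOver-⊤ (suc n) w = cong (w zero +_) (sumFin≡sumOver-⊤ n (w ∘ suc))

sumFin-if≡sumOver-tabulate : ∀ n (b : Fin n → Bool) (w : Fin n → ℚ) →
  sumFin n (λ i → if b i then w i else 0ℚ) ≡ sumOver (tabulate b) w
sumFin-if≡sumOver-tabulate ℕ.zero b w = refl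
sumFin-if≡sumOver-tabulate (suc n) b w with b zero
... | inside  = cong (w zero +_) (sumFin-if≡sumOver-tabulate n (b ∘ suc) (w ∘ suc))
... | outside = trans (+-identityˡ _) (sumFin-if≡sumOver-tabulate n (b ∘ suc) (w ∘ suc))

sumOver-⊥ : ∀ n (w : Fin n → ℚ) → sumOver ⊥ w ≡ 0ℚ
sumOver-⊥ ℕ.zero w = refl
sumOver-⊥ (suc n) w = sumOver-⊥ n (w ∘ suc)

sumOver-⁅⁆ : ∀ (i : Fin n) w → sumOver ⁅ i ⁆ w ≡ w i
sumOver-⁅⁆ {suc n} zero w = trans (cong (w zero +_) (sumOver-⊥ n (w ∘ suc))) (+-identityʳ (w zero))
sumOver-⁅⁆ (suc i) w = sumOver-⁅⁆ i (w ∘ suc)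

sumOver-nonNeg : ∀ (p : Subset n) → (∀ i → 0ℚ ≤ w i) → 0ℚ ≤ sumOver p w
sumOver-nonNeg []            w≥0 = ≤-refl
sumOver-nonNeg (outside ∷ p) w≥0 = sumOver-nonNeg p (w≥0 ∘ suc)
sumOver-nonNeg (inside  ∷ p) w≥0 =
  ≤-trans (w≥0 zero) (p≤p+q (sumOver-nonNeg p (w≥0 ∘ suc)))

sumOver-─ : ∀ {p q : Subset n} w → q ⊆ p → sumOver p w ≡ sumOver q w + sumOver (p ─ q) w
sumOver-─ {p = []}          {[]}          w q⊆p = sym (+-identityʳ 0ℚ)
sumOver-─ {p = outside ∷ p} {outside ∷ q} w q⊆p = sumOver-─ (w ∘ suc) (drop-∷-⊆ q⊆p)
sumOver-─ {p = outside ∷ p} {inside  ∷ q} w q⊆p with () ← q⊆p here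
sumOver-─ {p = inside  ∷ p} {outside ∷ q} w q⊆p =
  trans (cong (w zero +_) (sumOver-─ (w ∘ suc) (drop-∷-⊆ q⊆p)))
        (x∙yz≈y∙xz (w zero) (sumOver q (w ∘ suc)) _)
sumOver-─ {p = inside  ∷ p} {inside  ∷ q} w q⊆p =
  trans (cong (w zero +_) (sumOver-─ (w ∘ suc) (drop-∷-⊆ q⊆p)))
        (sym (+-assoc (w zero) (sumOver q (w ∘ suc)) _))

sumOver-mono : (∀ i → 0ℚ ≤ w i) → p ⊆ q → sumOver p w ≤ sumOver q w
sumOver-mono {w = w} {q = q} w≥0 p⊆q =
  ≤-trans (p≤p+q (sumOver-nonNeg (q ─ _) w≥0)) (≤-reflexive (sym (sumOver-─ w p⊆q)))

partSum≡sumOver-part : ∀ (c : Fin n → Fin m) k w → partSum c k w ≡ sumOver (part c k) w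
partSum≡sumOver-part {n} c k = sumFin-if≡sumOver-tabulate n (λ i → ⌊ c i ≟ k ⌋)

∈-part⁺ : ∀ {c : Fin n → Fin m} {k i} → c i ≡ k → i ∈ part c k
∈-part⁺ {c = c} {k} {i} ci≡k =
  lookup⇒[]= i _
    (trans (lookup∘tabulate _ i) (trans (isYes≗does (c i ≟ k)) (dec-true (c i ≟ k) ci≡k)))

∈-part⁻ : ∀ {c : Fin n → Fin m} {k i} → i ∈ part c k → c i ≡ k
∈-part⁻ {c = c} {k} {i} i∈part with c i ≟ k | trans (sym (lookup∘tabulate _ i)) ([]=⇒lookup i∈part)
... | yes ci≡k | _ = ci≡k
... | no _     | ()

⊆-singleton : p ⊆ q → ∣ q ∣ ≡ 1 → ∣ p ∣ ≡ 1 ⊎ p ≡ ⊥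
⊆-singleton {p = p} p⊆q ∣q∣≡1 with ∣ p ∣ in ∣p∣≡ | subst (∣ p ∣ ℕ.≤_) ∣q∣≡1 (p⊆q⇒∣p∣≤∣q∣ p⊆q)
... | 0           | _ = inj₂ (Empty-unique λ (x , x∈p) →
                            n≮0 (subst (∣ p ─ ⁅ x ⁆ ∣ ℕ.<_) ∣p∣≡ (x∈p⇒∣p-x∣<∣p∣ x∈p)))
... | 1           | _ = inj₁ refl
... | suc (suc _) | ℕ.s≤s ()

data SingletonOr (P : Subset n → Set) (p : Subset n) : Set where
  singleton : ∣ p ∣ ≡ 1 → SingletonOr P p
  holds     : P p → SingletonOr P p

SingletonOr⇒⊎ : ∀ {P : Subset n → Set} {A : Set} → (P p → A) → SingletonOr P p → ∣ p ∣ ≡ 1 ⊎ A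
SingletonOr⇒⊎ f (singleton ∣p∣≡1) = inj₁ ∣p∣≡1
SingletonOr⇒⊎ f (holds Pp)        = inj₂ (f Pp)

SingletonOr-map : ∀ {P Q : Subset n → Set} → (P p → Q p) → SingletonOr P p → SingletonOr Q p
SingletonOr-map f (singleton ∣p∣≡1) = singleton ∣p∣≡1
SingletonOr-map f (holds Pp)        = holds (f Pp)

SingletonOr-× : ∀ {P Q : Subset n → Set} →
                SingletonOr P p → SingletonOr Q p → SingletonOr (λ p → P p × Q p) p
SingletonOr-× (singleton ∣p∣≡1) _                 = singleton ∣p∣≡1
SingletonOr-× (holds _)         (singleton ∣p∣≡1) = singleton ∣p∣≡1
SingletonOr-× (holds Pp)        (holds Qp)        = holds (Pp , Qp)

SingletonOr-⊆ : ∀ {P : Subset n → Set} → (∀ {p q} → p ⊆ q → P q → P p) → P ⊥ →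
                p ⊆ q → SingletonOr P q → SingletonOr P p
SingletonOr-⊆ P-⊆ P⊥ p⊆q (holds Pq) = holds (P-⊆ p⊆q Pq)
SingletonOr-⊆ P-⊆ P⊥ p⊆q (singleton ∣q∣≡1) with ⊆-singleton p⊆q ∣q∣≡1
... | inj₁ ∣p∣≡1 = singleton ∣p∣≡1
... | inj₂ refl  = holds P⊥

Fits : (Fin n → ℚ) → ℚ → Subset n → Set
Fits w B p = sumOver p w ≤ B

Fits-⊆ : ∀ {B} → (∀ i → 0ℚ ≤ w i) → p ⊆ q → Fits w B q → Fits w B p
Fits-⊆ w≥0 p⊆q = ≤-trans (sumOver-mono w≥0 p⊆q)

Fits-⊥ : ∀ {B} → 0ℚ ≤ B → Fits w B ⊥
Fits-⊥ {n} {w} = subst (_≤ _) (sym (sumOver-⊥ n w))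

SingletonOrFits-⊆ : ∀ {B} → (∀ i → 0ℚ ≤ w i) → 0ℚ ≤ B →
                    p ⊆ q → SingletonOr (Fits w B) q → SingletonOr (Fits w B) p
SingletonOrFits-⊆ {w = w} w≥0 0≤B = SingletonOr-⊆ (Fits-⊆ w≥0) (Fits-⊥ {w = w} 0≤B)

-- The first item of p that does not fit under θ witnesses θ < sumOver q w + ε.
firstFit : ∀ (p : Subset n) {w θ ε} → 0ℚ ≤ θ → (∀ {i} → i ∈ p → w i ≤ ε) →
           ∃ λ q → q ⊆ p × Fits w θ q × (p ─ q ≡ ⊥ ⊎ θ < sumOver q w + ε)
firstFit [] 0≤θ small = [] , (λ ()) , 0≤θ , inj₁ refl
firstFit (outside ∷ p) {w} 0≤θ small with firstFit p {w ∘ suc} 0≤θ (small ∘ there)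
... | q , q⊆p , fits , full = outside ∷ q , out⊆ q⊆p , fits , map₁ (cong (outside ∷_)) full
firstFit (inside ∷ p) {w} {θ} {ε} 0≤θ small with w zero ≤? θ
... | no w₀≰θ =
  ⊥ , ⊥⊆ , Fits-⊥ {w = w} 0≤θ ,
  inj₂ (<-≤-trans (≰⇒> w₀≰θ) (≤-trans (small here)
         (≤-reflexive (sym (trans (cong (_+ ε) (sumOver-⊥ _ w)) (+-identityˡ ε))))))
... | yes w₀≤θ with firstFit p {w ∘ suc} (p≤q⇒0≤q-p w₀≤θ) (small ∘ there)
...   | q , q⊆p , fits , full =
  inside ∷ q , in⊆in q⊆p ,
  ≤-trans (+-monoʳ-≤ (w zero) fits) (≤-reflexive (p+[q-p]≡q (w zero) θ)) ,
  Sum.map (cong (outside ∷_)) nearlyFull full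
  where
    open Data.Rational.Properties.≤-Reasoning
    nearlyFull : θ - w zero < sumOver q (w ∘ suc) + ε → θ < w zero + sumOver q (w ∘ suc) + ε
    nearlyFull h = begin-strict
      θ                                      ≡⟨ sym (p+[q-p]≡q (w zero) θ) ⟩
      w zero + (θ - w zero)                  <⟨ +-monoʳ-< (w zero) h ⟩
      w zero + (sumOver q (w ∘ suc) + ε)     ≡⟨ sym (+-assoc (w zero) _ ε) ⟩
      w zero + sumOver q (w ∘ suc) + ε       ∎

splitInTwo : ∀ (p : Subset n) {w a B} → 0ℚ ≤ a → a + a ≤ B → sumOver p w ≤ B + a →
             ∃ λ q → q ⊆ p × SingletonOr (Fits w B) q × SingletonOr (Fits w B) (p ─ q)
splitInTwo p {w} {a} {B} 0≤a 2a≤B Σp≤B+a with any? (λ i → i ∈? p ×-dec a <? w i)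
... | yes (i , i∈p , a<wᵢ) = ⁅ i ⁆ , ⁅i⁆⊆p , singleton (∣⁅x⁆∣≡1 i) , holds rest
  where
    ⁅i⁆⊆p : ⁅ i ⁆ ⊆ p
    ⁅i⁆⊆p x∈⁅i⁆ = subst (_∈ p) (sym (x∈⁅y⁆⇒x≡y i x∈⁅i⁆)) i∈p
    Σp≡wᵢ+rest : sumOver p w ≡ w i + sumOver (p ─ ⁅ i ⁆) w
    Σp≡wᵢ+rest = trans (sumOver-─ w ⁅i⁆⊆p) (cong (_+ sumOver (p ─ ⁅ i ⁆) w) (sumOver-⁅⁆ i w))
    rest : Fits w B (p ─ ⁅ i ⁆)
    rest = p+q≤r+s⇒s≤p⇒q≤r (subst (_≤ B + a) Σp≡wᵢ+rest Σp≤B+a) (<⇒≤ a<wᵢ)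
... | no noHeavyItem =
  fromFirstFit (firstFit p 0≤2a (λ {i} i∈p → ≮⇒≥ (λ a<wᵢ → noHeavyItem (i , i∈p , a<wᵢ))))
  where
    0≤2a : 0ℚ ≤ a + a
    0≤2a = ≤-trans 0≤a (p≤p+q 0≤a)
    fromFirstFit : (∃ λ q → q ⊆ p × Fits w (a + a) q × (p ─ q ≡ ⊥ ⊎ a + a < sumOver q w + a)) →
                   ∃ λ q → q ⊆ p × SingletonOr (Fits w B) q × SingletonOr (Fits w B) (p ─ q)
    fromFirstFit (q , q⊆p , fits , full) = q , q⊆p , holds (≤-trans fits 2a≤B) , holds (rest full)
      where
        rest : p ─ q ≡ ⊥ ⊎ a + a < sumOver q w + a → Fits w B (p ─ q)
        rest (inj₁ p─q≡⊥) = subst (Fits w B) (sym p─q≡⊥) (Fits-⊥ {w = w} (≤-trans 0≤2a 2a≤B))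
        rest (inj₂ nearlyFull) =
          p+q≤r+s⇒s≤p⇒q≤r {sumOver q w} (subst (_≤ B + a) (sumOver-─ w q⊆p) Σp≤B+a)
                                        (+-cancelʳ-≤ a (<⇒≤ nearlyFull))

-- Two parts heavier than B would weigh more than B + B together.
atMostOneHeavyPart : ∀ (c : Fin n → Fin (suc m)) {w B} → (∀ i → 0ℚ ≤ w i) → sumOver ⊤ w ≤ B + B →
                     ∃ λ k₀ → ∀ k → k ≢ k₀ → Fits w B (part c k)
atMostOneHeavyPart c {w} {B} w≥0 total≤2B with any? (λ k → B <? sumOver (part c k) w)
... | no noHeavyPart = zero , λ k _ → ≮⇒≥ (λ B<Σk → noHeavyPart (k , B<Σk))
... | yes (k₀ , B<Σk₀) = k₀ , λ k k≢k₀ → ≤-trans (sumOver-mono w≥0 (part⊆rest k≢k₀)) restFits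
  where
    rest : Subset _
    rest = ⊤ ─ part c k₀
    part⊆rest : ∀ {k} → k ≢ k₀ → part c k ⊆ rest
    part⊆rest k≢k₀ i∈k =
      x∈p∧x∉q⇒x∈p─q ∈⊤ (λ i∈k₀ → k≢k₀ (trans (sym (∈-part⁻ i∈k)) (∈-part⁻ i∈k₀)))
    restFits : Fits w B rest
    restFits = p+q≤r+s⇒s≤p⇒q≤r (subst (_≤ B + B) (sumOver-─ w (⊆⊤ {p = part c k₀})) total≤2B)
                               (<⇒≤ B<Σk₀)

relabel : Subset n → (Fin n → Fin m) → Fin n → Fin (suc m)
relabel q c i with i ∈? q
... | yes _ = zero
... | no  _ = suc (c i)

part-relabel-zero : ∀ {q} {c : Fin n → Fin m} → part (relabel q c) zero ⊆ q
part-relabel-zero {q = q} {c} {i} i∈part with i ∈? q | ∈-part⁻ i∈part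
... | yes i∈q | _ = i∈q
... | no  _   | ()

part-relabel-suc : ∀ {q} {c : Fin n → Fin m} {k} → part (relabel q c) (suc k) ⊆ part c k ─ q
part-relabel-suc {q = q} {c} {k} {i} i∈part with i ∈? q | ∈-part⁻ i∈part
... | yes _   | ()
... | no  i∉q | sucᶜⁱ≡suck = x∈p∧x∉q⇒x∈p─q (∈-part⁺ (suc-injective sucᶜⁱ≡suck)) i∉q

Refines : (Fin n → Fin m′) → (Fin n → Fin m) → Set
Refines c′ c = ∀ k′ → ∃ λ k → part c′ k′ ⊆ part c k

SingletonOr-refine : ∀ {P : Subset n → Set} {c′ : Fin n → Fin m′} {c : Fin n → Fin m} →
                     (∀ {p q} → p ⊆ q → P q → P p) → P ⊥ → Refines c′ c →
                     (∀ k → SingletonOr P (part c k)) → ∀ k′ → SingletonOr P (part c′ k′)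
SingletonOr-refine P-⊆ P⊥ c′-refines-c fits k′ with c′-refines-c k′
... | k , k′⊆k = SingletonOr-⊆ P-⊆ P⊥ k′⊆k (fits k)

refine : ∀ (c : Fin n → Fin (suc m)) {w a B} → (∀ i → 0ℚ ≤ w i) → 0ℚ ≤ a → a + a ≤ B →
         sumOver ⊤ w ≤ B + a →
         ∃ λ (c′ : Fin n → Fin (suc (suc m))) →
           Refines c′ c × ∀ k′ → SingletonOr (Fits w B) (part c′ k′)
refine c {w} {a} {B} w≥0 0≤a 2a≤B total≤B+a
  with atMostOneHeavyPart c w≥0 (≤-trans total≤B+a (+-monoʳ-≤ B a≤B))
  where
    a≤B : a ≤ B
    a≤B = ≤-trans (p≤p+q 0≤a) 2a≤B
... | k₀ , lightParts
  with splitInTwo (part c k₀) 0≤a 2a≤B (≤-trans (sumOver-mono w≥0 (⊆⊤ {p = part c k₀})) total≤B+a)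
... | q , q⊆k₀ , qFits , restFits = relabel q c , refines , fits
  where
    0≤B : 0ℚ ≤ B
    0≤B = ≤-trans 0≤a (≤-trans (p≤p+q 0≤a) 2a≤B)
    refines : Refines (relabel q c) c
    refines zero    = k₀ , ⊆-trans part-relabel-zero q⊆k₀
    refines (suc k) = k  , ⊆-trans part-relabel-suc (p─q⊆p _ q)
    fits : ∀ k′ → SingletonOr (Fits w B) (part (relabel q c) k′)
    fits zero = SingletonOrFits-⊆ w≥0 0≤B part-relabel-zero qFits
    fits (suc k) with k ≟ k₀
    ... | yes refl = SingletonOrFits-⊆ w≥0 0≤B part-relabel-suc restFits
    ... | no  k≢k₀ = holds (Fits-⊆ w≥0 (⊆-trans part-relabel-suc (p─q⊆p _ q)) (lightParts k k≢k₀))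

-- A record rather than a Π-type, so that unification can recover v, B, D and p.
record FitsAll (v : Fin n → Fin d → ℚ) (B : Fin d → ℚ) (D : Subset d) (p : Subset n) : Set where
  constructor fitsAll
  field fits : ∀ j → j ∈ D → Fits (λ i → v i j) (B j) p

FitsAll-⊆ : ∀ {v : Fin n → Fin d → ℚ} {B D} → (∀ i j → 0ℚ ≤ v i j) →
            p ⊆ q → FitsAll v B D q → FitsAll v B D p
FitsAll-⊆ v≥0 p⊆q (fitsAll fits) = fitsAll λ j j∈D → Fits-⊆ (λ i → v≥0 i j) p⊆q (fits j j∈D)

FitsAll-⊥ : ∀ {v : Fin n → Fin d → ℚ} {B D} → (∀ j → j ∈ D → 0ℚ ≤ B j) → FitsAll v B D ⊥
FitsAll-⊥ {v = v} 0≤B = fitsAll λ j j∈D → Fits-⊥ {w = λ i → v i j} (0≤B j j∈D)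

FitsAll-[] : ∀ {v : Fin n → Fin 0 → ℚ} {B} → FitsAll v B [] p
FitsAll-[] = fitsAll λ _ ()

FitsAll-outside : ∀ {v : Fin n → Fin (suc d) → ℚ} {B D} →
                  FitsAll (λ i j → v i (suc j)) (B ∘ suc) D p → FitsAll v B (outside ∷ D) p
FitsAll-outside (fitsAll fits) = fitsAll λ where
  (suc j) (there j∈D) → fits j j∈D

FitsAll-inside : ∀ {v : Fin n → Fin (suc d) → ℚ} {B D} →
                 Fits (λ i → v i zero) (B zero) p × FitsAll (λ i j → v i (suc j)) (B ∘ suc) D p →
                 FitsAll v B (inside ∷ D) p
FitsAll-inside (fits₀ , fitsAll fits) = fitsAll λ where
  zero    here        → fits₀
  (suc j) (there j∈D) → fits j j∈D

module QuarterBounds {δ V : ℚ} (δ≤¼ : δ ≤ ¼) (0≤V : 0ℚ ≤ V) where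
  open +-*-Solver
  open Data.Rational.Properties.≤-Reasoning

  0≤¼V : 0ℚ ≤ ¼ * V
  0≤¼V = *-nonNeg (nonNegative⁻¹ ¼) 0≤V

  0≤[¼-δ]V : 0ℚ ≤ (¼ - δ) * V
  0≤[¼-δ]V = *-nonNeg (p≤q⇒0≤q-p δ≤¼) 0≤V

  ¼V+¼V≤[1-δ]V : ¼ * V + ¼ * V ≤ (1ℚ - δ) * V
  ¼V+¼V≤[1-δ]V = begin
    ¼ * V + ¼ * V                          ≤⟨ p≤p+q (≤-trans 0≤¼V (p≤p+q 0≤[¼-δ]V)) ⟩
    ¼ * V + ¼ * V + (¼ * V + (¼ - δ) * V)  ≡⟨ solve 2 (λ δ V → con ¼ :* V :+ con ¼ :* V
                                                                 :+ (con ¼ :* V :+ (con ¼ :- δ) :* V)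
                                                                 := (con 1ℚ :- δ) :* V) refl δ V ⟩
    (1ℚ - δ) * V                           ∎

  V≤[1-δ]V+¼V : V ≤ (1ℚ - δ) * V + ¼ * V
  V≤[1-δ]V+¼V = begin
    V                       ≤⟨ p≤p+q 0≤[¼-δ]V ⟩
    V + (¼ - δ) * V         ≡⟨ solve 2 (λ δ V → V :+ (con ¼ :- δ) :* V
                                              := (con 1ℚ :- δ) :* V :+ con ¼ :* V) refl δ V ⟩
    (1ℚ - δ) * V + ¼ * V    ∎

  0≤[1-δ]V : 0ℚ ≤ (1ℚ - δ) * V
  0≤[1-δ]V = ≤-trans 0≤¼V (≤-trans (p≤p+q 0≤¼V) ¼V+¼V≤[1-δ]V)

partition : ∀ {δ} → δ ≤ ¼ → ∀ (D : Subset d) (v : Fin n → Fin d → ℚ) (V : Fin d → ℚ) →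
            (∀ i j → 0ℚ ≤ v i j) → (∀ j → j ∈ D → 0ℚ ≤ V j) →
            (∀ j → j ∈ D → sumOver ⊤ (λ i → v i j) ≤ V j) →
            ∃ λ (c : Fin n → Fin (suc ∣ D ∣)) →
              ∀ k → SingletonOr (FitsAll v (λ j → (1ℚ - δ) * V j) D) (part c k)
partition δ≤¼ [] v V v≥0 V≥0 total≤V = (λ _ → zero) , λ _ → holds FitsAll-[]
partition δ≤¼ (outside ∷ D) v V v≥0 V≥0 total≤V
  with partition δ≤¼ D (λ i j → v i (suc j)) (V ∘ suc)
                 (λ i j → v≥0 i (suc j)) (λ j → V≥0 (suc j) ∘ there) (λ j → total≤V (suc j) ∘ there)
... | c , fits = c , λ k → SingletonOr-map FitsAll-outside (fits k)
partition {n = n} {δ = δ} δ≤¼ (inside ∷ D) v V v≥0 V≥0 total≤V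
  with partition δ≤¼ D (λ i j → v i (suc j)) (V ∘ suc)
                 (λ i j → v≥0 i (suc j)) (λ j → V≥0 (suc j) ∘ there) (λ j → total≤V (suc j) ∘ there)
... | c , fits =
  case refine c (λ i → v≥0 i zero) 0≤¼V ¼V+¼V≤[1-δ]V (≤-trans (total≤V zero here) V≤[1-δ]V+¼V)
  of λ where
    (c′ , c′-refines-c , fits₀) →
      c′ , λ k′ → SingletonOr-map FitsAll-inside
                    (SingletonOr-× (fits₀ k′) (inherited c′-refines-c k′))
  where
    open QuarterBounds δ≤¼ (V≥0 zero here)
    0≤Bₜ : ∀ j → j ∈ D → 0ℚ ≤ (1ℚ - δ) * V (suc j)
    0≤Bₜ j j∈D = QuarterBounds.0≤[1-δ]V δ≤¼ (V≥0 (suc j) (there j∈D))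
    inherited : ∀ {m′} {c′ : Fin n → Fin m′} → Refines c′ c → ∀ k′ →
                SingletonOr (FitsAll (λ i j → v i (suc j)) (λ j → (1ℚ - δ) * V (suc j)) D)
                            (part c′ k′)
    inherited c′-refines-c =
      SingletonOr-refine (FitsAll-⊆ (λ i j → v≥0 i (suc j))) (FitsAll-⊥ 0≤Bₜ) c′-refines-c fits

lemma36 : (d : ℕ) (D : Subset d) (δ : ℚ) → δ ≤ ½ * ½ →
          (n : ℕ) (v : Fin n → Fin d → ℚ) → (∀ i j → 0ℚ ≤ v i j) →
          (V : Fin d → ℚ) → (∀ j → j ∈ D → 0ℚ ≤ V j) →
          (∀ j → j ∈ D → sumFin n (λ i → v i j) ≤ V j) →
          Σ (Fin n → Fin (suc ∣ D ∣)) λ c →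
            ∀ k → ∣ part c k ∣ ≡ 1
                  ⊎ (∀ j → j ∈ D → partSum c k (λ i → v i j) ≤ (1ℚ - δ) * V j)
lemma36 d D δ δ≤¼ n v v≥0 V V≥0 total≤V =
  case partition δ≤¼ D v V v≥0 V≥0 totalOver⊤≤V of λ where
    (c , fits) → c , λ k → SingletonOr⇒⊎ (partSum≤ c k) (fits k)
  where
    totalOver⊤≤V : ∀ j → j ∈ D → sumOver ⊤ (λ i → v i j) ≤ V j
    totalOver⊤≤V j j∈D = subst (_≤ V j) (sumFin≡sumOver-⊤ n (λ i → v i j)) (total≤V j j∈D)
    partSum≤ : ∀ c k → FitsAll v (λ j → (1ℚ - δ) * V j) D (part c k) →
               ∀ j → j ∈ D → partSum c k (λ i → v i j) ≤ (1ℚ - δ) * V j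
    partSum≤ c k (fitsAll fits) j j∈D =
      subst (_≤ (1ℚ - δ) * V j) (sym (partSum≡sumOver-part c k (λ i → v i j))) (fits j j∈D)
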